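{- None of the following groups is Cayley integral: (1) the alternating group $A_4$; (2) $C_4\rtimes C_4=\langle x,y\mid x^4=y^4=1,\ y^{ -1}xy=x^{ -1}\rangle$; (3) $S_3\times C_3$; (4) the special linear group $SL(2,3)$; (5) $(C_4\ltimes C_3)\times C_2$, where $C_4\ltimes C_3=\langle a,b\mid a^3=b^4=1,\ b^{ -1}ab=a^{ -1}\rangle$; (6) $(C_4\times C_2)\rtimes C_4=\langle x,y\mid x^4=y^4=[x,y]^2=[x^2,y]=[x,y^2]=1\rangle$; (7) the non-abelian group of order $27$ and exponent $3$, $\langle x,y\mid x^3=y^3=(xy)^3=(xy^{ -1})^3=1\rangle$; (8) $(C_3\times C_3)\rtimes C_4=\langle x,y,z\mid x^3=y^3=z^4=[x,y]=1,\ z^{ -1}xz=x^{ -1},\ z^{ -1}yz=y^{ -1}\rangle$.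
   Context: For a finite group $G$ with identity $1$ and a subset $S\subseteq G\setminus\{1\}$ with $S=S^{ -1}$, the undirected Cayley graph $Cay(G,S)$ has vertex set $G$, with vertices $a,b$ adjacent whenever $ab^{ -1}\in S$. A graph is integral if all eigenvalues of its adjacency matrix are integers. A finite group $G$ is called Cayley integral if $Cay(G,S)$ is integral for every such subset $S$. $[x,y]=x^{ -1}y^{ -1}xy$; $C_n$ is the cyclic group of order $n$. -}

module Defs where

open import Data.Bool using (Bool; true; false; if_then_else_; _∧_; T)
open import Data.Bool.Properties using (T-∧)
open import Data.Nat as ℕ using (ℕ; zero; suc; NonZero; _≡ᵇ_; s≤s; _∸_)
open import Data.Nat.Properties using (≡ᵇ⇒≡; m≤n⇒m<n∨m≡n)
open import Data.Nat.DivMod using (_%_; _/_; m%n<n; m<n⇒m%n≡m)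
open import Data.Sum using (inj₁; inj₂)
open import Data.List using (List; []; _∷_; filterᵇ; upTo)
open import Function.Bundles using (Equivalence)
open import Data.Integer as ℤ using (ℤ; +_; _-_; _*_; -_)
open import Data.Fin as Fin using (Fin; zero; suc; toℕ; fromℕ<; punchIn)
open import Data.Fin.Properties using (toℕ-fromℕ<; toℕ-injective; toℕ<n) renaming (_≟_ to _≟F_)
open import Data.Product using (Σ; _×_; _,_; proj₁; proj₂)
open import Relation.Binary.PropositionalEquality
  using (_≡_; refl; sym; trans; cong; cong₂; isEquivalence; module ≡-Reasoning)
open import Relation.Nullary.Decidable using (⌊_⌋)
open import Algebra.Structures using (IsGroup; IsMonoid; IsSemigroup; IsMagma)

∑ : ∀ {n} → (Fin n → ℤ) → ℤ
∑ {zero}  f = + 0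
∑ {suc n} f = f zero ℤ.+ ∑ (λ i → f (suc i))

∏ : ∀ {n} → (Fin n → ℤ) → ℤ
∏ {zero}  f = + 1
∏ {suc n} f = f zero * ∏ (λ i → f (suc i))

sign : ℕ → ℤ
sign zero          = + 1
sign (suc zero)    = - (+ 1)
sign (suc (suc k)) = sign k

Matrix : ℕ → Set
Matrix n = Fin n → Fin n → ℤ

det : ∀ {n} → Matrix n → ℤ
det {zero}  M = + 1
det {suc n} M =
  ∑ (λ j → sign (toℕ j) * M zero j * det (λ r c → M (suc r) (punchIn j c)))

scalar : ∀ {n} → ℤ → Matrix n
scalar t i j = if ⌊ i ≟F j ⌋ then t else + 0

charPoly : ∀ {n} → Matrix n → ℤ → ℤ
charPoly A t = det (λ i j → scalar t i j - A i j)

-- A (square integer) matrix is integral iff all its eigenvalues are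
-- integers, i.e. its characteristic polynomial splits into linear factors
-- over ℤ: χ_A(t) = ∏ᵢ (t - λᵢ) with λᵢ ∈ ℤ (the eigenvalues, with
-- multiplicity).  Polynomial identity is expressed as equality of the
-- polynomial functions on ℤ (equivalent, ℤ being an infinite domain).
IsIntegral : ∀ {n} → Matrix n → Set
IsIntegral {n} A =
  Σ (Fin n → ℤ) λ eig → ∀ (t : ℤ) → charPoly A t ≡ ∏ (λ i → t - eig i)

record FiniteGroup : Set where
  field
    order   : ℕ
    _∙_     : Fin order → Fin order → Fin order
    ε       : Fin order
    _⁻¹     : Fin order → Fin order
    isGroup : IsGroup _≡_ _∙_ ε _⁻¹

module _ (G : FiniteGroup) where
  open FiniteGroup G

  cayleyAdj : (Fin order → Bool) → Matrix order
  cayleyAdj S a b = if S (a ∙ (b ⁻¹)) then + 1 else + 0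

  CayleyIntegral : Set
  CayleyIntegral =
    ∀ (S : Fin order → Bool) →
    S ε ≡ false →
    (∀ g → S (g ⁻¹) ≡ S g) →
    IsIntegral (cayleyAdj S)

-- Elements of a group of order N are
-- coded by the naturals 0 … N-1 (equivalently Fin N); the multiplication,
-- identity and inverse are given on codes, and the group axioms are
-- verified by exhaustive computation.

allBelow : ℕ → (ℕ → Bool) → Bool
allBelow zero    p = true
allBelow (suc n) p = p n ∧ allBelow n p

allBelow-sound : ∀ n p → T (allBelow n p) → ∀ m → m ℕ.< n → T (p m)
allBelow-sound (suc n) p h m (s≤s m≤n) with T-∧ {p n} {allBelow n p}
... | eqv with Equivalence.to eqv h | m≤n⇒m<n∨m≡n m≤n
...   | (hn , hr) | inj₁ m<n  = allBelow-sound n p hr m m<n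
...   | (hn , hr) | inj₂ refl = hn

allFin-sound : ∀ {n} p → T (allBelow n p) → ∀ (i : Fin n) → T (p (toℕ i))
allFin-sound {n} p h i = allBelow-sound n p h (toℕ i) (toℕ<n i)

module FromCode (N : ℕ) .{{_ : NonZero N}}
                (mulℕ : ℕ → ℕ → ℕ) (e : ℕ) (invℕ : ℕ → ℕ) where

  toF : ℕ → Fin N
  toF a = fromℕ< (m%n<n a N)

  mul : Fin N → Fin N → Fin N
  mul i j = toF (mulℕ (toℕ i) (toℕ j))

  unit : Fin N
  unit = toF e

  inv : Fin N → Fin N
  inv i = toF (invℕ (toℕ i))

  _·_ : ℕ → ℕ → ℕ
  a · b = mulℕ a b % N

  assocTest : ℕ → ℕ → ℕ → Bool
  assocTest a b c = ((a · b) % N) · c ≡ᵇ a · ((b · c) % N)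

  idTestˡ idTestʳ invTestˡ invTestʳ : ℕ → Bool
  idTestˡ  a = (e % N) · a ≡ᵇ a
  idTestʳ  a = a · (e % N) ≡ᵇ a
  invTestˡ a = (invℕ a % N) · a ≡ᵇ e % N
  invTestʳ a = a · (invℕ a % N) ≡ᵇ e % N

  axioms : Bool
  axioms =
    allBelow N (λ a → allBelow N (λ b → allBelow N (λ c → assocTest a b c)))
    ∧ allBelow N (λ a → idTestˡ a ∧ (idTestʳ a ∧ (invTestˡ a ∧ invTestʳ a)))

  private
    toℕ-toF : ∀ a → toℕ (toF a) ≡ a % N
    toℕ-toF a = toℕ-fromℕ< (m%n<n a N)

    toℕ-mul : ∀ i j → toℕ (mul i j) ≡ toℕ i · toℕ j
    toℕ-mul i j = toℕ-toF _

    ∧₁ : ∀ {x y} → T (x ∧ y) → T x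
    ∧₁ {x} {y} h = proj₁ (Equivalence.to (T-∧ {x} {y}) h)
    ∧₂ : ∀ {x y} → T (x ∧ y) → T y
    ∧₂ {x} {y} h = proj₂ (Equivalence.to (T-∧ {x} {y}) h)

    %-id : ∀ (i : Fin N) → toℕ i % N ≡ toℕ i
    %-id i = m<n⇒m%n≡m (toℕ<n i)

  module _ (ok : T axioms) where
    private
      hA = ∧₁ {allBelow N (λ a → allBelow N (λ b → allBelow N (λ c → assocTest a b c)))} ok
      hI = ∧₂ {allBelow N (λ a → allBelow N (λ b → allBelow N (λ c → assocTest a b c)))} ok
      pointI : ∀ (i : Fin N) → T (idTestˡ (toℕ i) ∧ (idTestʳ (toℕ i) ∧ (invTestˡ (toℕ i) ∧ invTestʳ (toℕ i))))
      pointI i = allFin-sound (λ a → idTestˡ a ∧ (idTestʳ a ∧ (invTestˡ a ∧ invTestʳ a))) hI i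
      A : ∀ (i j k : Fin N) → T (assocTest (toℕ i) (toℕ j) (toℕ k))
      A i j k = allFin-sound (assocTest (toℕ i) (toℕ j))
        (allFin-sound (λ b → allBelow N (assocTest (toℕ i) b))
          (allFin-sound (λ a → allBelow N (λ b → allBelow N (assocTest a b))) hA i) j) k
      I₁ : ∀ (i : Fin N) → T (idTestˡ (toℕ i))
      I₁ i = ∧₁ {idTestˡ (toℕ i)} (pointI i)
      I₂ : ∀ (i : Fin N) → T (idTestʳ (toℕ i))
      I₂ i = ∧₁ {idTestʳ (toℕ i)} (∧₂ {idTestˡ (toℕ i)} (pointI i))
      I₃ : ∀ (i : Fin N) → T (invTestˡ (toℕ i))
      I₃ i = ∧₁ {invTestˡ (toℕ i)} (∧₂ {idTestʳ (toℕ i)} (∧₂ {idTestˡ (toℕ i)} (pointI i)))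
      I₄ : ∀ (i : Fin N) → T (invTestʳ (toℕ i))
      I₄ i = ∧₂ {invTestˡ (toℕ i)} (∧₂ {idTestʳ (toℕ i)} (∧₂ {idTestˡ (toℕ i)} (pointI i)))

    assoc : ∀ i j k → mul (mul i j) k ≡ mul i (mul j k)
    assoc i j k = toℕ-injective (begin
        toℕ (mul (mul i j) k)            ≡⟨ toℕ-mul (mul i j) k ⟩
        toℕ (mul i j) · toℕ k            ≡⟨ cong (λ x → x · toℕ k) (sym (%-id (mul i j))) ⟩
        (toℕ (mul i j) % N) · toℕ k      ≡⟨ cong (λ x → (x % N) · toℕ k) (toℕ-mul i j) ⟩
        ((toℕ i · toℕ j) % N) · toℕ k
          ≡⟨ ≡ᵇ⇒≡ _ _ (A i j k) ⟩
        toℕ i · ((toℕ j · toℕ k) % N)    ≡⟨ cong (λ x → toℕ i · (x % N)) (sym (toℕ-mul j k)) ⟩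
        toℕ i · (toℕ (mul j k) % N)      ≡⟨ cong (λ x → toℕ i · x) (%-id (mul j k)) ⟩
        toℕ i · toℕ (mul j k)            ≡⟨ sym (toℕ-mul i (mul j k)) ⟩
        toℕ (mul i (mul j k))            ∎)
      where open ≡-Reasoning

    idˡ : ∀ i → mul unit i ≡ i
    idˡ i = toℕ-injective (trans (toℕ-toF _) (trans
      (cong (λ x → x · toℕ i) (toℕ-toF e))
      (≡ᵇ⇒≡ _ _ (I₁ i))))

    idʳ : ∀ i → mul i unit ≡ i
    idʳ i = toℕ-injective (trans (toℕ-toF _) (trans
      (cong (λ x → toℕ i · x) (toℕ-toF e))
      (≡ᵇ⇒≡ _ _ (I₂ i))))

    invˡ : ∀ i → mul (inv i) i ≡ unit
    invˡ i = toℕ-injective (trans (toℕ-toF _) (trans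
      (cong (λ x → x · toℕ i) (toℕ-toF _))
      (trans (≡ᵇ⇒≡ _ _ (I₃ i)) (sym (toℕ-toF e)))))

    invʳ : ∀ i → mul i (inv i) ≡ unit
    invʳ i = toℕ-injective (trans (toℕ-toF _) (trans
      (cong (λ x → toℕ i · x) (toℕ-toF _))
      (trans (≡ᵇ⇒≡ _ _ (I₄ i)) (sym (toℕ-toF e)))))

    isGroup : IsGroup _≡_ mul unit inv
    isGroup = record
      { isMonoid = record
        { isSemigroup = record
          { isMagma = record { isEquivalence = isEquivalence ; ∙-cong = cong₂ mul }
          ; assoc = assoc }
        ; identity = idˡ , idʳ }
      ; inverse = invˡ , invʳ
      ; ⁻¹-cong = cong inv }

    group : FiniteGroup
    group = record { order = N ; _∙_ = mul ; ε = unit ; _⁻¹ = inv ; isGroup = isGroup }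

even : ℕ → Bool
even zero          = true
even (suc zero)    = false
even (suc (suc n)) = even n

flipBy : (m : ℕ) .{{_ : NonZero m}} → ℕ → ℕ → ℕ
flipBy m j x = if even j then x % m else (m ∸ x % m) % m

neg : (m : ℕ) .{{_ : NonZero m}} → ℕ → ℕ
neg m x = (m ∸ x % m) % m

iter : ∀ {A : Set} → ℕ → (A → A) → A → A
iter zero    f x = x
iter (suc n) f x = f (iter n f x)

-- (1) A₄ ≅ (C₂ × C₂) ⋊ C₃, where C₃ acts by the order-3 automorphism
--     φ(a,b) = (b, a+b) of 𝔽₂².  Element ((a,b),k) has code a + 2b + 4k.

module A4Rep where
  φ : ℕ × ℕ → ℕ × ℕ
  φ (a , b) = (b , (a ℕ.+ b) % 2)
  dec : ℕ → (ℕ × ℕ) × ℕ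
  dec x = (((x % 4) % 2 , (x % 4) / 2) , x / 4)
  enc : (ℕ × ℕ) × ℕ → ℕ
  enc ((a , b) , k) = a ℕ.+ 2 ℕ.* b ℕ.+ 4 ℕ.* k
  op : (ℕ × ℕ) × ℕ → (ℕ × ℕ) × ℕ → (ℕ × ℕ) × ℕ
  op ((a , b) , k) (w , k') with iter k φ w
  ... | (p , q) = (((a ℕ.+ p) % 2 , (b ℕ.+ q) % 2) , (k ℕ.+ k') % 3)
  invT : (ℕ × ℕ) × ℕ → (ℕ × ℕ) × ℕ
  invT (v , k) = (iter (neg 3 k) φ v , neg 3 k)
  open FromCode 12 (λ x y → enc (op (dec x) (dec y))) 0 (λ x → enc (invT (dec x))) public

A₄ : FiniteGroup
A₄ = A4Rep.group _

-- (2) C₄ ⋊ C₄ = ⟨x,y ∣ x⁴=y⁴=1, y⁻¹xy=x⁻¹⟩ ; code i + 4j ↦ xⁱ yʲ,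
--     so that xⁱyʲ · xⁱ'yʲ' = x^(i + (-1)ʲ i') y^(j+j')

module C4⋊C4Rep where
  dec : ℕ → ℕ × ℕ
  dec x = (x % 4 , x / 4)
  enc : ℕ × ℕ → ℕ
  enc (i , j) = i ℕ.+ 4 ℕ.* j
  op : ℕ × ℕ → ℕ × ℕ → ℕ × ℕ
  op (i , j) (i' , j') = ((i ℕ.+ flipBy 4 j i') % 4 , (j ℕ.+ j') % 4)
  invT : ℕ × ℕ → ℕ × ℕ
  invT (i , j) = (neg 4 (flipBy 4 j i) , neg 4 j)
  open FromCode 16 (λ x y → enc (op (dec x) (dec y))) 0 (λ x → enc (invT (dec x))) public

C₄⋊C₄ : FiniteGroup
C₄⋊C₄ = C4⋊C4Rep.group _

-- (3) S₃ × C₃, with S₃ = ⟨r,s ∣ r³=s²=1, s⁻¹rs=r⁻¹⟩ ;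
--     code i + 3j + 6k ↦ (rⁱ sʲ , zᵏ)

module S3×C3Rep where
  dec : ℕ → (ℕ × ℕ) × ℕ
  dec x = ((x % 3 , (x / 3) % 2) , x / 6)
  enc : (ℕ × ℕ) × ℕ → ℕ
  enc ((i , j) , k) = i ℕ.+ 3 ℕ.* j ℕ.+ 6 ℕ.* k
  op : (ℕ × ℕ) × ℕ → (ℕ × ℕ) × ℕ → (ℕ × ℕ) × ℕ
  op ((i , j) , k) ((i' , j') , k') =
    (((i ℕ.+ flipBy 3 j i') % 3 , (j ℕ.+ j') % 2) , (k ℕ.+ k') % 3)
  invT : (ℕ × ℕ) × ℕ → (ℕ × ℕ) × ℕ
  invT ((i , j) , k) = ((neg 3 (flipBy 3 j i) , neg 2 j) , neg 3 k)
  open FromCode 18 (λ x y → enc (op (dec x) (dec y))) 0 (λ x → enc (invT (dec x))) public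

S₃×C₃ : FiniteGroup
S₃×C₃ = S3×C3Rep.group _

-- A matrix has "raw code"
--     a + 3b + 9c + 27d; the group element codes 0 … 23 index the list of
--     raw codes (in increasing order) of the determinant-one matrices.

module SL23Rep where
  Mat = (ℕ × ℕ) × (ℕ × ℕ)
  decM : ℕ → Mat
  decM x = ((x % 3 , (x / 3) % 3) , ((x / 9) % 3 , x / 27))
  encM : Mat → ℕ
  encM ((a , b) , (c , d)) = a ℕ.+ 3 ℕ.* b ℕ.+ 9 ℕ.* c ℕ.+ 27 ℕ.* d
  mulM : Mat → Mat → Mat
  mulM ((a , b) , (c , d)) ((a' , b') , (c' , d')) =
    ( ((a ℕ.* a' ℕ.+ b ℕ.* c') % 3 , (a ℕ.* b' ℕ.+ b ℕ.* d') % 3)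
    , ((c ℕ.* a' ℕ.+ d ℕ.* c') % 3 , (c ℕ.* b' ℕ.+ d ℕ.* d') % 3) )
  -- inverse of a determinant-one matrix
  invM : Mat → Mat
  invM ((a , b) , (c , d)) = ((d , neg 3 b) , (neg 3 c , a))
  detOne : ℕ → Bool
  detOne x with decM x
  ... | ((a , b) , (c , d)) = (a ℕ.* d ℕ.+ 2 ℕ.* (b ℕ.* c)) % 3 ≡ᵇ 1
  rawCodes : List ℕ
  rawCodes = filterᵇ detOne (upTo 81)
  -- the same list written out (used for efficient computation)
  rawCodes′ : List ℕ
  rawCodes′ = 15 ∷ 16 ∷ 17 ∷ 21 ∷ 22 ∷ 23 ∷ 28 ∷ 31 ∷ 34 ∷ 37 ∷ 41 ∷ 42 ∷
              46 ∷ 48 ∷ 53 ∷ 56 ∷ 59 ∷ 62 ∷ 65 ∷ 67 ∷ 69 ∷ 74 ∷ 75 ∷ 79 ∷ []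
  rawCodes≡ : rawCodes ≡ rawCodes′
  rawCodes≡ = refl
  nth : List ℕ → ℕ → ℕ
  nth []       _       = 0
  nth (x ∷ xs) zero    = x
  nth (x ∷ xs) (suc i) = nth xs i
  pos : List ℕ → ℕ → ℕ
  pos []       y = 0
  pos (x ∷ xs) y = if x ≡ᵇ y then 0 else suc (pos xs y)
  dec : ℕ → Mat
  dec x = decM (nth rawCodes′ x)
  enc : Mat → ℕ
  enc m = pos rawCodes′ (encM m)
  open FromCode 24 (λ x y → enc (mulM (dec x) (dec y))) (enc ((1 , 0) , (0 , 1)))
                   (λ x → enc (invM (dec x))) public

SL[2,3] : FiniteGroup
SL[2,3] = SL23Rep.group _

-- (5) (C₄ ⋉ C₃) × C₂, C₄ ⋉ C₃ = ⟨a,b ∣ a³=b⁴=1, b⁻¹ab=a⁻¹⟩ ;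
--     code i + 3j + 12k ↦ (aⁱ bʲ , cᵏ)

module C4⋉C3×C2Rep where
  dec : ℕ → (ℕ × ℕ) × ℕ
  dec x = ((x % 3 , (x / 3) % 4) , x / 12)
  enc : (ℕ × ℕ) × ℕ → ℕ
  enc ((i , j) , k) = i ℕ.+ 3 ℕ.* j ℕ.+ 12 ℕ.* k
  op : (ℕ × ℕ) × ℕ → (ℕ × ℕ) × ℕ → (ℕ × ℕ) × ℕ
  op ((i , j) , k) ((i' , j') , k') =
    (((i ℕ.+ flipBy 3 j i') % 3 , (j ℕ.+ j') % 4) , (k ℕ.+ k') % 2)
  invT : (ℕ × ℕ) × ℕ → (ℕ × ℕ) × ℕ
  invT ((i , j) , k) = ((neg 3 (flipBy 3 j i) , neg 4 j) , neg 2 k)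
  open FromCode 24 (λ x y → enc (op (dec x) (dec y))) 0 (λ x → enc (invT (dec x))) public

[C₄⋉C₃]×C₂ : FiniteGroup
[C₄⋉C₃]×C₂ = C4⋉C3×C2Rep.group _

-- (6) (C₄ × C₂) ⋊ C₄ = ⟨x,y ∣ x⁴=y⁴=[x,y]²=[x²,y]=[x,y²]=1⟩ ;
--     code i + 4j + 16k ↦ xⁱ yʲ zᵏ, where z = [x,y] is central of order 2
--     and yʲ xⁱ = xⁱ yʲ z^(ij)

module C4×C2⋊C4Rep where
  dec : ℕ → (ℕ × ℕ) × ℕ
  dec x = ((x % 4 , (x / 4) % 4) , x / 16)
  enc : (ℕ × ℕ) × ℕ → ℕ
  enc ((i , j) , k) = i ℕ.+ 4 ℕ.* j ℕ.+ 16 ℕ.* k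
  op : (ℕ × ℕ) × ℕ → (ℕ × ℕ) × ℕ → (ℕ × ℕ) × ℕ
  op ((i , j) , k) ((i' , j') , k') =
    (((i ℕ.+ i') % 4 , (j ℕ.+ j') % 4) , (k ℕ.+ k' ℕ.+ j ℕ.* i') % 2)
  invT : (ℕ × ℕ) × ℕ → (ℕ × ℕ) × ℕ
  invT ((i , j) , k) = ((neg 4 i , neg 4 j) , (k ℕ.+ i ℕ.* j) % 2)
  open FromCode 32 (λ x y → enc (op (dec x) (dec y))) 0 (λ x → enc (invT (dec x))) public

[C₄×C₂]⋊C₄ : FiniteGroup
[C₄×C₂]⋊C₄ = C4×C2⋊C4Rep.group _

-- (7) the non-abelian group of order 27 and exponent 3 (Heisenberg group
--     over 𝔽₃): code a + 3b + 9c ↦ (a,b,c), with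
--     (a,b,c)(a',b',c') = (a+a', b+b', c+c'+ab')

module Heis3Rep where
  dec : ℕ → (ℕ × ℕ) × ℕ
  dec x = ((x % 3 , (x / 3) % 3) , x / 9)
  enc : (ℕ × ℕ) × ℕ → ℕ
  enc ((a , b) , c) = a ℕ.+ 3 ℕ.* b ℕ.+ 9 ℕ.* c
  op : (ℕ × ℕ) × ℕ → (ℕ × ℕ) × ℕ → (ℕ × ℕ) × ℕ
  op ((a , b) , c) ((a' , b') , c') =
    (((a ℕ.+ a') % 3 , (b ℕ.+ b') % 3) , (c ℕ.+ c' ℕ.+ a ℕ.* b') % 3)
  invT : (ℕ × ℕ) × ℕ → (ℕ × ℕ) × ℕ
  invT ((a , b) , c) = ((neg 3 a , neg 3 b) , (neg 3 c ℕ.+ a ℕ.* b) % 3)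
  open FromCode 27 (λ x y → enc (op (dec x) (dec y))) 0 (λ x → enc (invT (dec x))) public

Heis₂₇ : FiniteGroup
Heis₂₇ = Heis3Rep.group _

-- (8) (C₃ × C₃) ⋊ C₄ = ⟨x,y,z ∣ x³=y³=z⁴=[x,y]=1, z⁻¹xz=x⁻¹, z⁻¹yz=y⁻¹⟩ ;
--     code i + 3j + 9k ↦ xⁱ yʲ zᵏ

module C3×C3⋊C4Rep where
  dec : ℕ → (ℕ × ℕ) × ℕ
  dec x = ((x % 3 , (x / 3) % 3) , x / 9)
  enc : (ℕ × ℕ) × ℕ → ℕ
  enc ((i , j) , k) = i ℕ.+ 3 ℕ.* j ℕ.+ 9 ℕ.* k
  op : (ℕ × ℕ) × ℕ → (ℕ × ℕ) × ℕ → (ℕ × ℕ) × ℕ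
  op ((i , j) , k) ((i' , j') , k') =
    (((i ℕ.+ flipBy 3 k i') % 3 , (j ℕ.+ flipBy 3 k j') % 3) , (k ℕ.+ k') % 4)
  invT : (ℕ × ℕ) × ℕ → (ℕ × ℕ) × ℕ
  invT ((i , j) , k) = ((neg 3 (flipBy 3 k i) , neg 3 (flipBy 3 k j)) , neg 4 k)
  open FromCode 36 (λ x y → enc (op (dec x) (dec y))) 0 (λ x → enc (invT (dec x))) public

[C₃×C₃]⋊C₄ : FiniteGroup
[C₃×C₃]⋊C₄ = C3×C3⋊C4Rep.group _

{-# OPTIONS --safe #-}
module Submission where

-- If Cay(G,S) were integral, its characteristic polynomial would factor as
-- χ(t) = ∏ᵢ (t − λᵢ) with λᵢ ∈ ℤ.  Reducing modulo Q, every λᵢ becomes a root of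
-- χ mod Q, so for any points t₁,…,tₖ the vector (χ(tⱼ) mod Q)ⱼ lies in the
-- multiplicative monoid generated by the vectors (tⱼ − a)ⱼ, a ranging over the
-- roots of χ mod Q.  For each group we choose S and Q and exhibit a set of vectors
-- that contains (1,…,1), is closed under these multiplications and misses
-- (χ(tⱼ) mod Q)ⱼ.  The values of χ mod Q are computed by Gaussian elimination,
-- proved sound against the Laplace expansion that defines det.

open import Data.Bool as Bool using (Bool; if_then_else_)
open import Data.Bool.ListAction using (any)
import Data.Bool.Properties as Bool
open import Data.Fin using (Fin; zero; suc; toℕ; punchIn)
import Data.Fin.Properties as Fin
open import Data.Integer as ℤ using (ℤ; +_; 0ℤ; 1ℤ; -1ℤ; _+_; _*_; -_; _-_)
open import Data.Integer.DivMod using (_%ℕ_; _/ℕ_; a≡a%ℕn+[a/ℕn]*n; n%ℕd<d)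
open import Data.Integer.Divisibility.Signed
  using (_∣_; divides; ∣m⇒∣-m; ∣m∣n⇒∣m+n; ∣m⇒∣m*n; ∣n⇒∣m*n; ∣⇒∣ᵤ)
import Data.Integer.Properties as ℤ
open import Data.Integer.Tactic.RingSolver using (solve-∀)
open import Data.List as List using (List; []; _∷_; _++_; length; tabulate; allFin)
open import Data.List.Membership.Propositional using (_∈_; _∉_)
open import Data.List.Membership.Propositional.Properties using (∈-insert)
import Data.List.Properties as List
open import Data.List.Relation.Binary.Pointwise as Pointwise using (Pointwise; []; _∷_; tabulate⁺)
import Data.List.Relation.Binary.Pointwise.Properties as Pointwise
open import Data.List.Relation.Unary.All as All using (All; []; _∷_)
open import Data.List.Relation.Unary.Any using (here; there)
open import Data.Maybe as Maybe using (Maybe; just; nothing)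
import Data.Maybe.Properties as Maybe
open import Data.Maybe.Relation.Unary.Any as MaybeAny using () renaming (Any to MaybeAny)
open import Data.Nat as ℕ using (ℕ; zero; suc; NonZero; _≡ᵇ_; _∸_)
open import Data.Nat.Divisibility using (>⇒∤) renaming (_∣_ to _∣ℕ_)
import Data.Nat.Properties as ℕ
open import Data.List.Membership.DecPropositional ℕ._≟_ using () renaming (_∈?_ to _∈ℕ?_)
open import Data.List.Membership.DecPropositional (List.≡-dec ℕ._≟_) using (_∈?_)
open import Data.Product using (∃; _×_; _,_; proj₁; proj₂)
open import Data.Sum using (_⊎_; inj₁; inj₂)
open import Data.Unit using (tt)
open import Data.Vec as Vec using (Vec; []; _∷_)
open import Data.Vec.Properties using (lookup-zipWith; lookup∘tabulate)
open import Function using (_∘_; id)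
open import Level using (0ℓ)
open import Relation.Binary.Bundles using (Setoid)
open import Relation.Binary.PropositionalEquality
import Relation.Binary.Reasoning.Setoid as ≈-Reasoning
open import Relation.Binary.Structures using (IsEquivalence)
open import Relation.Nullary using (¬_; Dec; contradiction; yes; no; ¬?)
open import Relation.Nullary.Decidable using (True; toWitness; _×-dec_; _⊎-dec_)

open import Defs

sign-suc : ∀ n → sign (suc n) ≡ - sign n
sign-suc zero          = refl
sign-suc (suc zero)    = refl
sign-suc (suc (suc n)) = sign-suc n

i≡-i⇒i≡0 : ∀ {i} → i ≡ - i → i ≡ 0ℤ
i≡-i⇒i≡0 {+ zero} _ = refl

Row : Set → Set
Row C = C → ℤ

module _ {C : Set} where
  open ≡-Reasoning

  -- laplace r minor cs = Σⱼ (-1)ʲ · r cⱼ · minor (cs without cⱼ), so Det rs cs is the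
  -- determinant of the rows rs restricted to the columns cs (0 if their numbers differ).
  laplace : Row C → (List C → ℤ) → List C → ℤ
  laplace r minor []       = 0ℤ
  laplace r minor (c ∷ cs) = r c * minor cs - laplace r (minor ∘ (c ∷_)) cs

  Det : List (Row C) → List C → ℤ
  Det []       []      = 1ℤ
  Det []       (_ ∷ _) = 0ℤ
  Det (r ∷ rs) cs      = laplace r (Det rs) cs

  laplace-cong : ∀ {r r′ minor minor′} → (∀ c → r c ≡ r′ c) → (∀ cs → minor cs ≡ minor′ cs) →
                 ∀ cs → laplace r minor cs ≡ laplace r′ minor′ cs
  laplace-cong r≡ m≡ []       = refl
  laplace-cong r≡ m≡ (c ∷ cs) =
    cong₂ _-_ (cong₂ _*_ (r≡ c) (m≡ cs)) (laplace-cong r≡ (m≡ ∘ (c ∷_)) cs)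

  laplace-zeroˡ : ∀ r {minor} cs → All (λ c → r c ≡ 0ℤ) cs → laplace r minor cs ≡ 0ℤ
  laplace-zeroˡ r         []       []            = refl
  laplace-zeroˡ r {minor} (c ∷ cs) (rc≡0 ∷ r≡0)
    rewrite rc≡0 | laplace-zeroˡ r {minor ∘ (c ∷_)} cs r≡0 = refl

  laplace-zeroʳ : ∀ r {minor} → (∀ cs → minor cs ≡ 0ℤ) → ∀ cs → laplace r minor cs ≡ 0ℤ
  laplace-zeroʳ r m≡0 []       = refl
  laplace-zeroʳ r m≡0 (c ∷ cs)
    rewrite m≡0 cs | laplace-zeroʳ r (m≡0 ∘ (c ∷_)) cs | ℤ.*-zeroʳ (r c) = refl

  laplace-linearʳ : ∀ r x minor₁ minor₂ cs →
                    laplace r (λ ys → x * minor₁ ys - minor₂ ys) cs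
                    ≡ x * laplace r minor₁ cs - laplace r minor₂ cs
  laplace-linearʳ r x m₁ m₂ []       = sym (trans (ℤ.+-identityʳ (x * 0ℤ)) (ℤ.*-zeroʳ x))
  laplace-linearʳ r x m₁ m₂ (c ∷ cs) = begin
    r c * (x * m₁ cs - m₂ cs) - laplace r (λ ys → x * m₁ (c ∷ ys) - m₂ (c ∷ ys)) cs
      ≡⟨ cong (_-_ (r c * (x * m₁ cs - m₂ cs))) (laplace-linearʳ r x (m₁ ∘ (c ∷_)) (m₂ ∘ (c ∷_)) cs) ⟩
    r c * (x * m₁ cs - m₂ cs) - (x * laplace r (m₁ ∘ (c ∷_)) cs - laplace r (m₂ ∘ (c ∷_)) cs)
      ≡⟨ regroup (r c) x (m₁ cs) (m₂ cs) _ _ ⟩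
    x * (r c * m₁ cs - laplace r (m₁ ∘ (c ∷_)) cs) - (r c * m₂ cs - laplace r (m₂ ∘ (c ∷_)) cs) ∎
    where
    regroup : ∀ a x u v u′ v′ → a * (x * u - v) - (x * u′ - v′) ≡ x * (a * u - u′) - (a * v - v′)
    regroup = solve-∀

  laplace-linearˡ : ∀ r s μ minor cs →
                    laplace (λ c → r c + μ * s c) minor cs ≡ laplace r minor cs + μ * laplace s minor cs
  laplace-linearˡ r s μ m []       = sym (trans (ℤ.+-identityˡ (μ * 0ℤ)) (ℤ.*-zeroʳ μ))
  laplace-linearˡ r s μ m (c ∷ cs) = begin
    (r c + μ * s c) * m cs - laplace (λ c → r c + μ * s c) (m ∘ (c ∷_)) cs
      ≡⟨ cong (_-_ ((r c + μ * s c) * m cs)) (laplace-linearˡ r s μ (m ∘ (c ∷_)) cs) ⟩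
    (r c + μ * s c) * m cs - (laplace r (m ∘ (c ∷_)) cs + μ * laplace s (m ∘ (c ∷_)) cs)
      ≡⟨ regroup (r c) (s c) μ (m cs) _ _ ⟩
    (r c * m cs - laplace r (m ∘ (c ∷_)) cs) + μ * (s c * m cs - laplace s (m ∘ (c ∷_)) cs) ∎
    where
    regroup : ∀ a b μ k u v → (a + μ * b) * k - (u + μ * v) ≡ (a * k - u) + μ * (b * k - v)
    regroup = solve-∀

  laplace-anticomm : ∀ r s minor cs → laplace r (laplace s minor) cs ≡ - laplace s (laplace r minor) cs
  laplace-anticomm r s m []       = refl
  laplace-anticomm r s m (c ∷ cs) = begin
    r c * laplace s m cs - laplace r (laplace s m ∘ (c ∷_)) cs
      ≡⟨ cong (_-_ (r c * laplace s m cs)) (laplace-linearʳ r (s c) m (laplace s (m ∘ (c ∷_))) cs) ⟩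
    r c * laplace s m cs - (s c * laplace r m cs - laplace r (laplace s (m ∘ (c ∷_))) cs)
      ≡⟨ cong (λ z → r c * laplace s m cs - (s c * laplace r m cs - z)) (laplace-anticomm r s (m ∘ (c ∷_)) cs) ⟩
    r c * laplace s m cs - (s c * laplace r m cs - - laplace s (laplace r (m ∘ (c ∷_))) cs)
      ≡⟨ regroup (r c) (s c) _ _ _ ⟩
    - (s c * laplace r m cs - (r c * laplace s m cs - laplace s (laplace r (m ∘ (c ∷_))) cs))
      ≡⟨ cong (λ z → - (s c * laplace r m cs - z)) (laplace-linearʳ s (r c) m (laplace r (m ∘ (c ∷_))) cs) ⟨
    - laplace s (laplace r m) (c ∷ cs) ∎
    where
    regroup : ∀ a b u v w → a * u - (b * v - - w) ≡ - (b * v - (a * u - w))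
    regroup = solve-∀

  Det-repeated-row : ∀ r rs cs → Det (r ∷ r ∷ rs) cs ≡ 0ℤ
  Det-repeated-row r rs cs = i≡-i⇒i≡0 (laplace-anticomm r r (Det rs) cs)

  AddsMultipleOf : Row C → Row C → Row C → Set
  AddsMultipleOf p s s′ = ∃ λ μ → ∀ c → s′ c ≡ s c + μ * p c

  Det-add-multiples : ∀ p {rs rs′} → Pointwise (AddsMultipleOf p) rs rs′ →
                      ∀ cs → Det (p ∷ rs′) cs ≡ Det (p ∷ rs) cs
  Det-add-multiples p []                                         cs = refl
  Det-add-multiples p {s ∷ rs} {s′ ∷ rs′} ((μ , s′≡) ∷ rs′≡) cs = begin
    laplace p (laplace s′ (Det rs′)) cs
      ≡⟨ laplace-anticomm p s′ (Det rs′) cs ⟩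
    - laplace s′ (Det (p ∷ rs′)) cs
      ≡⟨ cong -_ (laplace-cong s′≡ (Det-add-multiples p rs′≡) cs) ⟩
    - laplace (λ c → s c + μ * p c) (Det (p ∷ rs)) cs
      ≡⟨ cong -_ (laplace-linearˡ s p μ (Det (p ∷ rs)) cs) ⟩
    - (Det (s ∷ p ∷ rs) cs + μ * Det (p ∷ p ∷ rs) cs)
      ≡⟨ cong (λ z → - (Det (s ∷ p ∷ rs) cs + μ * z)) (Det-repeated-row p rs cs) ⟩
    - (Det (s ∷ p ∷ rs) cs + μ * 0ℤ)
      ≡⟨ cong (λ z → - (Det (s ∷ p ∷ rs) cs + z)) (ℤ.*-zeroʳ μ) ⟩
    - (Det (s ∷ p ∷ rs) cs + 0ℤ)
      ≡⟨ cong -_ (ℤ.+-identityʳ _) ⟩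
    - laplace s (laplace p (Det rs)) cs
      ≡⟨ cong -_ (laplace-anticomm s p (Det rs) cs) ⟩
    - - laplace p (laplace s (Det rs)) cs
      ≡⟨ ℤ.neg-involutive _ ⟩
    laplace p (laplace s (Det rs)) cs ∎

  VanishesAt : C → (List C → ℤ) → Set
  VanishesAt c minor = ∀ cs → c ∈ cs → minor cs ≡ 0ℤ

  laplace-vanishesAt : ∀ r {minor} c → r c ≡ 0ℤ → VanishesAt c minor → VanishesAt c (laplace r minor)
  laplace-vanishesAt r c rc≡0 m≡0 (c ∷ cs) (here refl)
    rewrite rc≡0 | laplace-zeroʳ r (λ ys → m≡0 (c ∷ ys) (here refl)) cs = refl
  laplace-vanishesAt r {m} c rc≡0 m≡0 (d ∷ cs) (there c∈cs)
    rewrite m≡0 cs c∈cs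
          | laplace-vanishesAt r {m ∘ (d ∷_)} c rc≡0 (λ ys → m≡0 (d ∷ ys) ∘ there) cs c∈cs
          | ℤ.*-zeroʳ (r d) = refl

  Det-vanishesAt : ∀ c {rs} → All (λ s → s c ≡ 0ℤ) rs → VanishesAt c (Det rs)
  Det-vanishesAt c []             (_ ∷ _) _ = refl
  Det-vanishesAt c (sc≡0 ∷ rsc≡0) cs c∈cs   = laplace-vanishesAt _ c sc≡0 (Det-vanishesAt c rsc≡0) cs c∈cs

  laplace-pivot : ∀ p {minor} c → VanishesAt c minor → ∀ pre post →
                  laplace p minor (pre ++ c ∷ post) ≡ sign (length pre) * p c * minor (pre ++ post)
  laplace-pivot p {m} c m≡0 [] post = begin
    p c * m post - laplace p (m ∘ (c ∷_)) post
      ≡⟨ cong (_-_ (p c * m post)) (laplace-zeroʳ p (λ ys → m≡0 (c ∷ ys) (here refl)) post) ⟩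
    p c * m post + 0ℤ
      ≡⟨ ℤ.+-identityʳ _ ⟩
    p c * m post
      ≡⟨ cong (_* m post) (ℤ.*-identityˡ (p c)) ⟨
    1ℤ * p c * m post ∎
  laplace-pivot p {m} c m≡0 (d ∷ pre) post = begin
    p d * m (pre ++ c ∷ post) - laplace p (m ∘ (d ∷_)) (pre ++ c ∷ post)
      ≡⟨ cong₂ (λ u v → p d * u - v) (m≡0 (pre ++ c ∷ post) (∈-insert {v = c} pre))
                                      (laplace-pivot p c (λ ys → m≡0 (d ∷ ys) ∘ there) pre post) ⟩
    p d * 0ℤ - sign (length pre) * p c * m (d ∷ pre ++ post)
      ≡⟨ regroup (p d) (sign (length pre)) (p c) _ ⟩
    (- sign (length pre)) * p c * m (d ∷ pre ++ post)
      ≡⟨ cong (λ s → s * p c * m (d ∷ pre ++ post)) (sign-suc (length pre)) ⟨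
    sign (length (d ∷ pre)) * p c * m (d ∷ pre ++ post) ∎
    where
    regroup : ∀ a s b k → a * 0ℤ - s * b * k ≡ (- s) * b * k
    regroup = solve-∀

∑-cong : ∀ {k} {f g : Fin k → ℤ} → (∀ i → f i ≡ g i) → ∑ f ≡ ∑ g
∑-cong {zero}  f≡g = refl
∑-cong {suc k} f≡g = cong₂ _+_ (f≡g zero) (∑-cong (f≡g ∘ suc))

∑-neg : ∀ {k} (f : Fin k → ℤ) → ∑ (λ i → - f i) ≡ - ∑ f
∑-neg {zero}  f = refl
∑-neg {suc k} f = begin
  - f zero + ∑ (λ i → - f (suc i)) ≡⟨ cong (_+_ (- f zero)) (∑-neg (f ∘ suc)) ⟩
  - f zero + - ∑ (f ∘ suc)         ≡⟨ ℤ.neg-distrib-+ (f zero) _ ⟨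
  - ∑ f                            ∎
  where open ≡-Reasoning

module _ {C : Set} where
  open ≡-Reasoning

  laplace-tabulate : ∀ {k} r minor (f : Fin (suc k) → C) →
                     laplace r minor (tabulate f)
                     ≡ ∑ (λ j → sign (toℕ j) * r (f j) * minor (tabulate (f ∘ punchIn j)))
  laplace-tabulate {zero}  r m f = cong (λ x → x * m [] + 0ℤ) (sym (ℤ.*-identityˡ (r (f zero))))
  laplace-tabulate {suc k} r m f = begin
    r (f zero) * m (tabulate (f ∘ suc)) - laplace r (m ∘ (f zero ∷_)) (tabulate (f ∘ suc))
      ≡⟨ cong (_-_ (r (f zero) * m (tabulate (f ∘ suc)))) (laplace-tabulate r (m ∘ (f zero ∷_)) (f ∘ suc)) ⟩
    r (f zero) * m (tabulate (f ∘ suc)) - ∑ term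
      ≡⟨ cong (_+_ (r (f zero) * m (tabulate (f ∘ suc)))) (∑-neg term) ⟨
    r (f zero) * m (tabulate (f ∘ suc)) + ∑ (λ j → - term j)
      ≡⟨ cong₂ _+_ (cong (_* m (tabulate (f ∘ suc))) (ℤ.*-identityˡ (r (f zero)))) (∑-cong shift-sign) ⟨
    ∑ (λ j → sign (toℕ j) * r (f j) * m (tabulate (f ∘ punchIn j))) ∎
    where
    term : Fin (suc k) → ℤ
    term j = sign (toℕ j) * r (f (suc j)) * m (f zero ∷ tabulate (f ∘ suc ∘ punchIn j))

    shift-sign : ∀ j → sign (suc (toℕ j)) * r (f (suc j)) * m (f zero ∷ tabulate (f ∘ suc ∘ punchIn j)) ≡ - term j
    shift-sign j = trans (cong (λ s → s * a * b) (sign-suc (toℕ j))) (sym (neg-distrib (sign (toℕ j)) a b))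
      where
      a b : ℤ
      a = r (f (suc j))
      b = m (f zero ∷ tabulate (f ∘ suc ∘ punchIn j))
      neg-distrib : ∀ s a b → - (s * a * b) ≡ (- s) * a * b
      neg-distrib = solve-∀

  det-tabulate : ∀ {k} (R : Fin k → Row C) (f : Fin k → C) →
                 det (λ i j → R i (f j)) ≡ Det (tabulate R) (tabulate f)
  det-tabulate {zero}  R f = refl
  det-tabulate {suc k} R f = begin
    ∑ (λ j → sign (toℕ j) * R zero (f j) * det (λ i l → R (suc i) (f (punchIn j l))))
      ≡⟨ ∑-cong (λ j → cong (sign (toℕ j) * R zero (f j) *_) (det-tabulate (R ∘ suc) (f ∘ punchIn j))) ⟩
    ∑ (λ j → sign (toℕ j) * R zero (f j) * Det (tabulate (R ∘ suc)) (tabulate (f ∘ punchIn j)))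
      ≡⟨ laplace-tabulate (R zero) (Det (tabulate (R ∘ suc))) f ⟨
    Det (tabulate R) (tabulate f) ∎

det≡Det : ∀ {n} (M : Matrix n) → det M ≡ Det (tabulate M) (allFin n)
det≡Det M = det-tabulate M id

module Congruence (Q : ℕ) where

  infix 4 _≈_
  record _≈_ (a b : ℤ) : Set where
    constructor congruent
    field
      divides-difference : + Q ∣ a - b

  ≈-reflexive : ∀ {a b} → a ≡ b → a ≈ b
  ≈-reflexive {a} refl = congruent (divides 0ℤ (ℤ.+-inverseʳ a))

  ≈-refl : ∀ {a} → a ≈ a
  ≈-refl = ≈-reflexive refl

  ≈-sym : ∀ {a b} → a ≈ b → b ≈ a
  ≈-sym {a} {b} (congruent Q∣a-b) = congruent (subst (+ Q ∣_) (flip a b) (∣m⇒∣-m Q∣a-b))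
    where
    flip : ∀ a b → - (a - b) ≡ b - a
    flip = solve-∀

  ≈-trans : ∀ {a b c} → a ≈ b → b ≈ c → a ≈ c
  ≈-trans {a} {b} {c} (congruent Q∣a-b) (congruent Q∣b-c) =
    congruent (subst (+ Q ∣_) (telescope a b c) (∣m∣n⇒∣m+n Q∣a-b Q∣b-c))
    where
    telescope : ∀ a b c → (a - b) + (b - c) ≡ a - c
    telescope = solve-∀

  ≈-isEquivalence : IsEquivalence _≈_
  ≈-isEquivalence = record { refl = ≈-refl ; sym = ≈-sym ; trans = ≈-trans }

  ≈-setoid : Setoid 0ℓ 0ℓ
  ≈-setoid = record { isEquivalence = ≈-isEquivalence }

  +-cong : ∀ {a b c d} → a ≈ b → c ≈ d → a + c ≈ b + d
  +-cong {a} {b} {c} {d} (congruent Q∣a-b) (congruent Q∣c-d) =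
    congruent (subst (+ Q ∣_) (regroup a b c d) (∣m∣n⇒∣m+n Q∣a-b Q∣c-d))
    where
    regroup : ∀ a b c d → (a - b) + (c - d) ≡ (a + c) - (b + d)
    regroup = solve-∀

  -‿cong : ∀ {a b} → a ≈ b → - a ≈ - b
  -‿cong {a} {b} (congruent Q∣a-b) = congruent (subst (+ Q ∣_) (regroup a b) (∣m⇒∣-m Q∣a-b))
    where
    regroup : ∀ a b → - (a - b) ≡ - a - - b
    regroup = solve-∀

  *-cong : ∀ {a b c d} → a ≈ b → c ≈ d → a * c ≈ b * d
  *-cong {a} {b} {c} {d} (congruent Q∣a-b) (congruent Q∣c-d) =
    congruent (subst (+ Q ∣_) (regroup a b c d) (∣m∣n⇒∣m+n (∣m⇒∣m*n c Q∣a-b) (∣n⇒∣m*n b Q∣c-d)))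
    where
    regroup : ∀ a b c d → (a - b) * c + b * (c - d) ≡ a * c - b * d
    regroup = solve-∀

  ∏-≈0 : ∀ {k} (f : Fin k → ℤ) i → f i ≈ 0ℤ → ∏ f ≈ 0ℤ
  ∏-≈0 f zero    fi≈0 = *-cong fi≈0 ≈-refl
  ∏-≈0 f (suc i) fi≈0 =
    ≈-trans (*-cong (≈-refl {f zero}) (∏-≈0 (f ∘ suc) i fi≈0)) (≈-reflexive (ℤ.*-zeroʳ (f zero)))

  residue-≈ : .{{_ : NonZero Q}} → ∀ a → + (a %ℕ Q) ≈ a
  residue-≈ a = congruent (divides (- (a /ℕ Q)) (begin
    + (a %ℕ Q) - a                               ≡⟨ cong (_-_ (+ (a %ℕ Q))) (a≡a%ℕn+[a/ℕn]*n a Q) ⟩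
    + (a %ℕ Q) - (+ (a %ℕ Q) + (a /ℕ Q) * + Q)  ≡⟨ cancel (+ (a %ℕ Q)) (a /ℕ Q) (+ Q) ⟩
    - (a /ℕ Q) * + Q                             ∎))
    where
    open ≡-Reasoning
    cancel : ∀ r k q → r - (r + k * q) ≡ - k * q
    cancel = solve-∀

  -1≈Q∸1 : .{{_ : NonZero Q}} → -1ℤ ≈ + (Q ∸ 1)
  -1≈Q∸1 = congruent (divides -1ℤ (trans (regroup (+ (Q ∸ 1))) (cong (-1ℤ *_) Q∸1+1≡Q)))
    where
    regroup : ∀ x → -1ℤ - x ≡ -1ℤ * (x + 1ℤ)
    regroup = solve-∀
    Q∸1+1≡Q : + (Q ∸ 1) + 1ℤ ≡ + Q
    Q∸1+1≡Q = trans (sym (ℤ.pos-+ (Q ∸ 1) 1)) (cong +_ (ℕ.m∸n+n≡m (ℕ.>-nonZero⁻¹ Q)))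

  ≈-residue-injective : ∀ {x y} → x ℕ.< Q → y ℕ.< Q → + x ≈ + y → x ≡ y
  ≈-residue-injective {x} {y} x<Q y<Q (congruent Q∣x-y) =
    ℤ.+-injective (ℤ.i-j≡0⇒i≡j (+ x) (+ y) (ℤ.∣i∣≡0⇒i≡0 (multiple-below-Q (∣⇒∣ᵤ Q∣x-y) ∣x-y∣<Q)))
    where
    ∣x-y∣<Q : ℤ.∣ + x - + y ∣ ℕ.< Q
    ∣x-y∣<Q = ℕ.≤-<-trans (subst (ℕ._≤ x ℕ.⊔ y) (cong ℤ.∣_∣ (sym (ℤ.m-n≡m⊖n x y))) (ℤ.∣m⊝n∣≤m⊔n x y))
                          (ℕ.⊔-pres-<m x<Q y<Q)
    multiple-below-Q : ∀ {n} → Q ∣ℕ n → n ℕ.< Q → n ≡ 0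
    multiple-below-Q {zero}  _   _   = refl
    multiple-below-Q {suc n} Q∣n n<Q = contradiction Q∣n (>⇒∤ n<Q)

  module _ {C : Set} where

    RowCongruence : Row C → Row C → Set
    RowCongruence r r′ = ∀ c → r c ≈ r′ c

    laplace-≈ : ∀ {r r′ minor minor′} → RowCongruence r r′ → (∀ cs → minor cs ≈ minor′ cs) →
                ∀ cs → laplace r minor cs ≈ laplace r′ minor′ cs
    laplace-≈ r≈ m≈ []       = ≈-refl
    laplace-≈ r≈ m≈ (c ∷ cs) = +-cong (*-cong (r≈ c) (m≈ cs)) (-‿cong (laplace-≈ r≈ (m≈ ∘ (c ∷_)) cs))

    Det-≈ : ∀ {rs rs′} → Pointwise RowCongruence rs rs′ → ∀ cs → Det rs cs ≈ Det rs′ cs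
    Det-≈ []          []      = ≈-refl
    Det-≈ []          (_ ∷ _) = ≈-refl
    Det-≈ (r≈ ∷ rs≈) cs      = laplace-≈ r≈ (Det-≈ rs≈) cs

    AddsMultipleOf-≈ : Row C → Row C → Row C → Set
    AddsMultipleOf-≈ p s s′ = ∃ λ μ → ∀ c → s′ c ≈ s c + μ * p c

    Det-add-multiples-≈ : ∀ p {rs rs′} → Pointwise (AddsMultipleOf-≈ p) rs rs′ →
                          ∀ cs → Det (p ∷ rs′) cs ≈ Det (p ∷ rs) cs
    Det-add-multiples-≈ p {rs} {rs′} rs′≈ cs = begin
      Det (p ∷ rs′) cs         ≈⟨ Det-≈ ((λ _ → ≈-refl) ∷ exact≈ rs′≈) cs ⟨
      Det (p ∷ exact rs′≈) cs  ≡⟨ Det-add-multiples p (exact-adds rs′≈) cs ⟩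
      Det (p ∷ rs) cs          ∎
      where
      open ≈-Reasoning ≈-setoid
      exact : ∀ {rs rs′} → Pointwise (AddsMultipleOf-≈ p) rs rs′ → List (Row C)
      exact []                       = []
      exact {s ∷ _} ((μ , _) ∷ rs′≈) = (λ c → s c + μ * p c) ∷ exact rs′≈
      exact-adds : ∀ {rs rs′} (rs′≈ : Pointwise (AddsMultipleOf-≈ p) rs rs′) →
                   Pointwise (AddsMultipleOf p) rs (exact rs′≈)
      exact-adds []               = []
      exact-adds ((μ , _) ∷ rs′≈) = (μ , λ _ → refl) ∷ exact-adds rs′≈
      exact≈ : ∀ {rs rs′} (rs′≈ : Pointwise (AddsMultipleOf-≈ p) rs rs′) →
               Pointwise RowCongruence (exact rs′≈) rs′
      exact≈ []                 = []
      exact≈ ((_ , s′≈) ∷ rs′≈) = (≈-sym ∘ s′≈) ∷ exact≈ rs′≈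

module Elimination (q n : ℕ) where

  Q : ℕ
  Q = suc q

  open Congruence Q

  toRow : Vec ℕ n → Row (Fin n)
  toRow v c = + Vec.lookup v c

  toRows : ∀ {m} → Vec (Vec ℕ n) m → List (Row (Fin n))
  toRows []       = []
  toRows (v ∷ vs) = toRow v ∷ toRows vs

  inverse : ℕ → ℕ
  inverse x = search q
    where
    search : ℕ → ℕ
    search zero    = 0
    search (suc y) = if (x ℕ.* suc y) ℕ.% Q ≡ᵇ 1 then suc y else search y

  addMultiple : ℕ → Vec ℕ n → Vec ℕ n → Vec ℕ n
  addMultiple μ s p = Vec.zipWith (λ a b → (a ℕ.+ μ ℕ.* b) ℕ.% Q) s p

  multiplier : Vec ℕ n → Fin n → Vec ℕ n → ℕ
  multiplier p c s = Q ∸ (Vec.lookup s c ℕ.* inverse (Vec.lookup p c)) ℕ.% Q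

  eliminate : Vec ℕ n → Fin n → Vec ℕ n → Vec ℕ n
  eliminate p c s = addMultiple (multiplier p c s) s p

  pivot : Vec ℕ n → List (Fin n) → Maybe (List (Fin n) × Fin n × List (Fin n))
  pivot p []       = nothing
  pivot p (c ∷ cs) with Vec.lookup p c ℕ.≟ 0
  ... | yes _ = Maybe.map (λ (pre , d , post) → c ∷ pre , d , post) (pivot p cs)
  ... | no _  = just ([] , c , cs)

  zeroAt : ∀ {m} → Fin n → Vec (Vec ℕ n) m → Bool
  zeroAt c []       = Bool.true
  zeroAt c (s ∷ ss) with Vec.lookup s c ℕ.≟ 0
  ... | yes _ = zeroAt c ss
  ... | no _  = Bool.false

  -- q stands for -1 modulo Q.
  signMod : ℕ → ℕ
  signMod k = if even k then 1 else q

  -- The elimination step is checked (zeroAt) rather than proved correct, so detMod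
  -- gives nothing when it fails, e.g. when the pivot has no inverse modulo Q.
  detMod : ∀ {m} → Vec (Vec ℕ n) m → List (Fin n) → Maybe ℕ
  detMod []       []      = just 1
  detMod []       (_ ∷ _) = just 0
  detMod (p ∷ rs) cs with pivot p cs
  ... | nothing               = just 0
  ... | just (pre , c , post) with Vec.map (eliminate p c) rs
  ...   | rs′ with zeroAt c rs′
  ...     | Bool.false = nothing
  ...     | Bool.true  = Maybe.map (λ v → (signMod (length pre) ℕ.* Vec.lookup p c ℕ.* v) ℕ.% Q)
                                   (detMod rs′ (pre ++ post))

  pivot-split : ∀ p cs {pre c post} → pivot p cs ≡ just (pre , c , post) → cs ≡ pre ++ c ∷ post
  pivot-split p (c ∷ cs) eq with Vec.lookup p c ℕ.≟ 0
  pivot-split p (c ∷ cs) refl | no _ = refl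
  ... | yes _ with pivot p cs in eq′
  pivot-split p (c ∷ cs) refl | yes _ | just _ = cong (c ∷_) (pivot-split p cs eq′)

  pivot-none : ∀ p cs → pivot p cs ≡ nothing → All (λ c → toRow p c ≡ 0ℤ) cs
  pivot-none p []       _  = []
  pivot-none p (c ∷ cs) eq with Vec.lookup p c ℕ.≟ 0
  ... | yes pc≡0 with pivot p cs in eq′
  ...   | nothing = cong +_ pc≡0 ∷ pivot-none p cs eq′

  zeroAt-sound : ∀ {m} c (ss : Vec (Vec ℕ n) m) → zeroAt c ss ≡ Bool.true → All (λ s → s c ≡ 0ℤ) (toRows ss)
  zeroAt-sound c []       _  = []
  zeroAt-sound c (s ∷ ss) eq with Vec.lookup s c ℕ.≟ 0
  ... | yes sc≡0 = cong +_ sc≡0 ∷ zeroAt-sound c ss eq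

  addMultiple-≈ : ∀ μ s p x → toRow (addMultiple μ s p) x ≈ toRow s x + + μ * toRow p x
  addMultiple-≈ μ s p x = begin
    + Vec.lookup (addMultiple μ s p) x                  ≡⟨ cong +_ (lookup-zipWith _ x s p) ⟩
    + ((Vec.lookup s x ℕ.+ μ ℕ.* Vec.lookup p x) ℕ.% Q) ≈⟨ residue-≈ (+ (Vec.lookup s x ℕ.+ μ ℕ.* Vec.lookup p x)) ⟩
    + (Vec.lookup s x ℕ.+ μ ℕ.* Vec.lookup p x)         ≡⟨ ℤ.pos-+ (Vec.lookup s x) _ ⟩
    toRow s x + + (μ ℕ.* Vec.lookup p x)                ≡⟨ cong (_+_ (toRow s x)) (ℤ.pos-* μ _) ⟩
    toRow s x + + μ * toRow p x                         ∎
    where open ≈-Reasoning ≈-setoid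

  eliminate-rows : ∀ {m} p c (rs : Vec (Vec ℕ n) m) →
                   Pointwise (AddsMultipleOf-≈ (toRow p)) (toRows rs) (toRows (Vec.map (eliminate p c) rs))
  eliminate-rows p c []       = []
  eliminate-rows p c (s ∷ rs) = (+ μ , addMultiple-≈ μ s p) ∷ eliminate-rows p c rs
    where
    μ : ℕ
    μ = multiplier p c s

  signMod-≈ : ∀ k → sign k ≈ + signMod k
  signMod-≈ zero          = ≈-refl
  signMod-≈ (suc zero)    = -1≈Q∸1
  signMod-≈ (suc (suc k)) = signMod-≈ k

  detMod-sound : ∀ {m} (rs : Vec (Vec ℕ n) m) cs {v} → detMod rs cs ≡ just v → Det (toRows rs) cs ≈ + v
  detMod-sound []       []      refl = ≈-refl
  detMod-sound []       (_ ∷ _) refl = ≈-refl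
  detMod-sound (p ∷ rs) cs eq with pivot p cs in pivot≡
  detMod-sound (p ∷ rs) cs refl | nothing = ≈-reflexive (laplace-zeroˡ (toRow p) cs (pivot-none p cs pivot≡))
  ... | just (pre , c , post) with zeroAt c (Vec.map (eliminate p c) rs) in zero≡
  ...   | Bool.true with detMod (Vec.map (eliminate p c) rs) (pre ++ post) in det≡
  detMod-sound {suc m} (p ∷ rs) cs refl | just (pre , c , post) | Bool.true | just v
    rewrite pivot-split p cs pivot≡ = begin
    Det (toRow p ∷ toRows rs) (pre ++ c ∷ post)
      ≈⟨ Det-add-multiples-≈ (toRow p) (eliminate-rows p c rs) (pre ++ c ∷ post) ⟨
    Det (toRow p ∷ toRows rs′) (pre ++ c ∷ post)
      ≡⟨ laplace-pivot (toRow p) c (Det-vanishesAt c (zeroAt-sound c rs′ zero≡)) pre post ⟩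
    sign (length pre) * toRow p c * Det (toRows rs′) (pre ++ post)
      ≈⟨ *-cong (*-cong (signMod-≈ (length pre)) ≈-refl) (detMod-sound rs′ (pre ++ post) det≡) ⟩
    + signMod (length pre) * + Vec.lookup p c * + v
      ≡⟨ cong (_* + v) (ℤ.pos-* (signMod (length pre)) _) ⟨
    + (signMod (length pre) ℕ.* Vec.lookup p c) * + v
      ≡⟨ ℤ.pos-* (signMod (length pre) ℕ.* Vec.lookup p c) v ⟨
    + (signMod (length pre) ℕ.* Vec.lookup p c ℕ.* v)
      ≈⟨ residue-≈ (+ (signMod (length pre) ℕ.* Vec.lookup p c ℕ.* v)) ⟨
    + ((signMod (length pre) ℕ.* Vec.lookup p c ℕ.* v) ℕ.% Q) ∎
    where
    open ≈-Reasoning ≈-setoid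
    rs′ : Vec (Vec ℕ n) m
    rs′ = Vec.map (eliminate p c) rs

  toRows-tabulate : ∀ {m} (F : Fin m → Vec ℕ n) → toRows (Vec.tabulate F) ≡ tabulate (toRow ∘ F)
  toRows-tabulate {zero}  F = refl
  toRows-tabulate {suc m} F = cong (toRow (F zero) ∷_) (toRows-tabulate (F ∘ suc))

module Sampling (q : ℕ) where

  Q : ℕ
  Q = suc q

  open Congruence Q

  Samples : List ℕ → (ℤ → ℤ) → List ℕ → Set
  Samples ts f s = Pointwise (λ t x → f (+ t) ≈ + x) ts s

  -- q * a stands for -a modulo Q.
  mulFactor : List ℕ → ℕ → List ℕ → List ℕ
  mulFactor ts a s = List.zipWith (λ t x → ((t ℕ.+ q ℕ.* a) ℕ.* x) ℕ.% Q) ts s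

  Samples-cong : ∀ {ts f g s} → (∀ t → f t ≡ g t) → Samples ts f s → Samples ts g s
  Samples-cong f≡g = Pointwise.map λ {t} fx≈ → ≈-trans (≈-reflexive (sym (f≡g (+ t)))) fx≈

  Samples-one : ∀ ts → Samples ts (λ _ → 1ℤ) (List.map (λ _ → 1) ts)
  Samples-one []       = []
  Samples-one (t ∷ ts) = ≈-refl ∷ Samples-one ts

  Samples-mulFactor : ∀ {ts f s e a} → e ≈ + a → Samples ts f s →
                      Samples ts (λ t → (t - e) * f t) (mulFactor ts a s)
  Samples-mulFactor e≈a [] = []
  Samples-mulFactor {t ∷ _} {f} {e = e} {a} e≈a (_∷_ {y = x} fx≈ fs≈) = (begin
    (+ t - e) * f (+ t)                 ≈⟨ *-cong (+-cong (≈-refl {+ t}) (-‿cong e≈a)) fx≈ ⟩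
    (+ t - + a) * + x                   ≈⟨ *-cong t-a≈ ≈-refl ⟩
    + (t ℕ.+ q ℕ.* a) * + x             ≡⟨ ℤ.pos-* (t ℕ.+ q ℕ.* a) x ⟨
    + ((t ℕ.+ q ℕ.* a) ℕ.* x)           ≈⟨ residue-≈ (+ ((t ℕ.+ q ℕ.* a) ℕ.* x)) ⟨
    + (((t ℕ.+ q ℕ.* a) ℕ.* x) ℕ.% Q)   ∎) ∷ Samples-mulFactor {f = f} e≈a fs≈
    where
    open ≈-Reasoning ≈-setoid
    t-a≈ : + t - + a ≈ + (t ℕ.+ q ℕ.* a)
    t-a≈ = begin
      + t - + a          ≡⟨ cong (_+_ (+ t)) (ℤ.-1*i≡-i (+ a)) ⟨
      + t + -1ℤ * + a    ≈⟨ +-cong (≈-refl {+ t}) (*-cong -1≈Q∸1 ≈-refl) ⟩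
      + t + + q * + a    ≡⟨ cong (_+_ (+ t)) (ℤ.pos-* q a) ⟨
      + t + + (q ℕ.* a)  ≡⟨ ℤ.pos-+ t (q ℕ.* a) ⟨
      + (t ℕ.+ q ℕ.* a)  ∎

  Samples-unique : ∀ {ts f s s′} → Samples ts f s → Samples ts f s′ →
                   All (ℕ._< Q) s → All (ℕ._< Q) s′ → s ≡ s′
  Samples-unique []          []            []           []            = refl
  Samples-unique {f = f} (fx≈ ∷ fs≈) (fx′≈ ∷ fs′≈) (x<Q ∷ s<Q) (x′<Q ∷ s′<Q) =
    cong₂ _∷_ (≈-residue-injective x<Q x′<Q (≈-trans (≈-sym fx≈) fx′≈))
              (Samples-unique {f = f} fs≈ fs′≈ s<Q s′<Q)

-- The modulus is Q = q + 1; values are meant to be χ(t) mod Q at the points t.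
record Certificate (G : FiniteGroup) : Set where
  field
    connectionSet : Fin (FiniteGroup.order G) → Bool
    q             : ℕ
    roots         : List ℕ
    points        : List ℕ
    values        : List ℕ
    reachable     : List (List ℕ)

module Certified {G : FiniteGroup} (cert : Certificate G) where

  open FiniteGroup G
  open Certificate cert
  open Elimination q order
  open Sampling q hiding (Q)
  open Congruence Q

  A : Matrix order
  A = cayleyAdj G connectionSet

  charPolyResidues : ℕ → Vec (Vec ℕ order) order
  charPolyResidues r = Vec.tabulate λ i → Vec.tabulate λ j → (scalar (+ r) i j - A i j) %ℕ Q

  charPolyMod : ℕ → Maybe ℕ
  charPolyMod r = detMod (charPolyResidues r) (allFin order)

  charPolyMod-sound : ∀ r {v} → charPolyMod r ≡ just v → charPoly A (+ r) ≈ + v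
  charPolyMod-sound r {v} eq = begin
    charPoly A (+ r)                                  ≡⟨ det≡Det M ⟩
    Det (tabulate M) (allFin order)                   ≈⟨ Det-≈ rows≈ (allFin order) ⟩
    Det (toRows (charPolyResidues r)) (allFin order)  ≈⟨ detMod-sound (charPolyResidues r) (allFin order) eq ⟩
    + v                                               ∎
    where
    open ≈-Reasoning ≈-setoid
    M : Matrix order
    M i j = scalar (+ r) i j - A i j
    rows≈ : Pointwise RowCongruence (tabulate M) (toRows (charPolyResidues r))
    rows≈ = subst (Pointwise RowCongruence (tabulate M)) (sym (toRows-tabulate _)) (tabulate⁺ λ i j →
      ≈-sym (≈-trans (≈-reflexive (cong +_ (lookup∘tabulate _ j))) (residue-≈ (M i j))))

  NonRoot : ℕ → Set
  NonRoot a = MaybeAny (λ v → v ≢ 0 × v ℕ.< Q) (charPolyMod a)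

  RootsComplete : Set
  RootsComplete = ∀ {a} → a ℕ.< Q → a ∈ roots ⊎ NonRoot a

  IsCharPolyMod : ℕ → ℕ → Set
  IsCharPolyMod t v = v ℕ.< Q × charPolyMod t ≡ just v

  ones : List ℕ
  ones = List.map (λ _ → 1) points

  ReachableClosed : Set
  ReachableClosed = All (λ s → All (ℕ._< Q) s × All (λ a → mulFactor points a s ∈ reachable) roots) reachable

  Valid : Set
  Valid = connectionSet ε ≡ Bool.false
        × (∀ g → connectionSet (g ⁻¹) ≡ connectionSet g)
        × RootsComplete
        × Pointwise IsCharPolyMod points values
        × ones ∈ reachable
        × ReachableClosed
        × values ∉ reachable

  valid? : Dec Valid
  valid? = connectionSet ε Bool.≟ Bool.false
    ×-dec Fin.all? (λ g → connectionSet (g ⁻¹) Bool.≟ connectionSet g)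
    ×-dec ℕ.allUpTo? (λ a → a ∈ℕ? roots ⊎-dec MaybeAny.dec (λ v → ¬? (v ℕ.≟ 0) ×-dec v ℕ.<? Q) (charPolyMod a)) Q
    ×-dec Pointwise.decidable (λ t v → v ℕ.<? Q ×-dec Maybe.≡-dec ℕ._≟_ (charPolyMod t) (just v)) points values
    ×-dec ones ∈? reachable
    ×-dec All.all? (λ s → All.all? (ℕ._<? Q) s ×-dec All.all? (λ a → mulFactor points a s ∈? reachable) roots)
                   reachable
    ×-dec ¬? (values ∈? reachable)

  nonRoot-nonvanishing : ∀ {a} → NonRoot a → ¬ charPoly A (+ a) ≈ 0ℤ
  nonRoot-nonvanishing {a} nonRoot χ≈0 with charPolyMod a in eq | nonRoot
  ... | just v | MaybeAny.just (v≢0 , v<Q) =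
    v≢0 (≈-residue-injective v<Q (ℕ.s≤s ℕ.z≤n) (≈-trans (≈-sym (charPolyMod-sound a eq)) χ≈0))

  eigenvalue-residues-are-roots : RootsComplete → ∀ {eig : Fin order → ℤ} →
                                  (∀ t → charPoly A t ≡ ∏ (λ i → t - eig i)) → ∀ i → eig i %ℕ Q ∈ roots
  eigenvalue-residues-are-roots complete {eig} χ≡∏ i with complete (n%ℕd<d (eig i) Q)
  ... | inj₁ root    = root
  ... | inj₂ nonRoot = contradiction χ≈0 (nonRoot-nonvanishing nonRoot)
    where
    χ≈0 : charPoly A (+ (eig i %ℕ Q)) ≈ 0ℤ
    χ≈0 = ≈-trans (≈-reflexive (χ≡∏ (+ (eig i %ℕ Q))))
                  (∏-≈0 _ i (≈-trans (+-cong (residue-≈ (eig i)) ≈-refl) (≈-reflexive (ℤ.+-inverseʳ (eig i)))))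

  products-reachable : ones ∈ reachable → ReachableClosed →
                       ∀ {k} (e : Fin k → ℤ) → (∀ i → e i %ℕ Q ∈ roots) →
                       ∃ λ s → s ∈ reachable × Samples points (λ t → ∏ (λ i → t - e i)) s
  products-reachable ones∈ closed {zero}  e e-roots = ones , ones∈ , Samples-one points
  products-reachable ones∈ closed {suc k} e e-roots
    with products-reachable ones∈ closed (e ∘ suc) (e-roots ∘ suc)
  ... | s , s∈ , s-samples =
    mulFactor points (e zero %ℕ Q) s ,
    All.lookup (proj₂ (All.lookup closed s∈)) (e-roots zero) ,
    Samples-mulFactor {f = λ t → ∏ (λ i → t - e (suc i))} (≈-sym (residue-≈ (e zero))) s-samples

  values-sample-charPoly : ∀ {ts vs} → Pointwise IsCharPolyMod ts vs →
                           Samples ts (charPoly A) vs × All (ℕ._< Q) vs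
  values-sample-charPoly []                      = [] , []
  values-sample-charPoly ((v<Q , χ≡v) ∷ correct) with values-sample-charPoly correct
  ... | samples , vs<Q = charPolyMod-sound _ χ≡v ∷ samples , v<Q ∷ vs<Q

  valid⇒¬CayleyIntegral : Valid → ¬ CayleyIntegral G
  valid⇒¬CayleyIntegral (ε∉S , S-symmetric , complete , correct , ones∈ , closed , values∉) integral
    with integral connectionSet ε∉S S-symmetric
  ... | eig , χ≡∏ with products-reachable ones∈ closed eig (eigenvalue-residues-are-roots complete χ≡∏)
  ... | s , s∈ , s-samples with values-sample-charPoly correct
  ... | values-samples , values<Q = values∉ (subst (_∈ reachable) s≡values s∈)
    where
    s≡values : s ≡ values
    s≡values = Samples-unique {f = charPoly A} (Samples-cong (sym ∘ χ≡∏) s-samples) values-samples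
                              (proj₁ (All.lookup closed s∈)) values<Q

refute : ∀ {G} (cert : Certificate G) → True (Certified.valid? cert) → ¬ CayleyIntegral G
refute cert valid = Certified.valid⇒¬CayleyIntegral cert (toWitness valid)

-- The certificates were found by computer search; group elements are given by their codes in Defs.
withCodes : ∀ {n} → List ℕ → Fin n → Bool
withCodes codes x = any (toℕ x ≡ᵇ_) codes

A₄-certificate : Certificate A₄
A₄-certificate = record
  { connectionSet = withCodes (1 ∷ 2 ∷ 4 ∷ 8 ∷ [])
  ; q             = 4
  ; roots         = 1 ∷ 4 ∷ []
  ; points        = 0 ∷ 3 ∷ []
  ; values        = 1 ∷ 3 ∷ []
  ; reachable     = (1 ∷ 1 ∷ []) ∷ (1 ∷ 4 ∷ []) ∷ (4 ∷ 2 ∷ []) ∷ (4 ∷ 3 ∷ []) ∷ []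
  }

C₄⋊C₄-certificate : Certificate C₄⋊C₄
C₄⋊C₄-certificate = record
  { connectionSet = withCodes (4 ∷ 5 ∷ 12 ∷ 13 ∷ [])
  ; q             = 10
  ; roots         = 0 ∷ 4 ∷ 7 ∷ []
  ; points        = 3 ∷ 5 ∷ []
  ; values        = 4 ∷ 5 ∷ []
  ; reachable     = (1 ∷ 1 ∷ []) ∷ (2 ∷ 3 ∷ []) ∷ (3 ∷ 5 ∷ []) ∷ (4 ∷ 9 ∷ []) ∷ (5 ∷ 4 ∷ []) ∷ (6 ∷ 4 ∷ []) ∷ (7 ∷ 9 ∷ []) ∷ (8 ∷ 5 ∷ []) ∷
                    (9 ∷ 3 ∷ []) ∷ (10 ∷ 1 ∷ []) ∷ []
  }

S₃×C₃-certificate : Certificate S₃×C₃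
S₃×C₃-certificate = record
  { connectionSet = withCodes (3 ∷ 4 ∷ 9 ∷ 15 ∷ [])
  ; q             = 4
  ; roots         = 1 ∷ 4 ∷ []
  ; points        = 0 ∷ 3 ∷ []
  ; values        = 1 ∷ 3 ∷ []
  ; reachable     = (1 ∷ 1 ∷ []) ∷ (1 ∷ 4 ∷ []) ∷ (4 ∷ 2 ∷ []) ∷ (4 ∷ 3 ∷ []) ∷ []
  }

SL[2,3]-certificate : Certificate SL[2,3]
SL[2,3]-certificate = record
  { connectionSet = withCodes (0 ∷ 1 ∷ 3 ∷ 7 ∷ 8 ∷ 13 ∷ [])
  ; q             = 10
  ; roots         = 0 ∷ 6 ∷ 9 ∷ []
  ; points        = 5 ∷ 7 ∷ []
  ; values        = 6 ∷ 6 ∷ []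
  ; reachable     = (1 ∷ 1 ∷ []) ∷ (1 ∷ 10 ∷ []) ∷ (2 ∷ 3 ∷ []) ∷ (2 ∷ 8 ∷ []) ∷ (3 ∷ 5 ∷ []) ∷ (3 ∷ 6 ∷ []) ∷ (4 ∷ 2 ∷ []) ∷ (4 ∷ 9 ∷ []) ∷
                    (5 ∷ 4 ∷ []) ∷ (5 ∷ 7 ∷ []) ∷ (6 ∷ 4 ∷ []) ∷ (6 ∷ 7 ∷ []) ∷ (7 ∷ 2 ∷ []) ∷ (7 ∷ 9 ∷ []) ∷ (8 ∷ 5 ∷ []) ∷ (8 ∷ 6 ∷ []) ∷
                    (9 ∷ 3 ∷ []) ∷ (9 ∷ 8 ∷ []) ∷ (10 ∷ 1 ∷ []) ∷ (10 ∷ 10 ∷ []) ∷ []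
  }

[C₄×C₂]⋊C₄-certificate : Certificate [C₄×C₂]⋊C₄
[C₄×C₂]⋊C₄-certificate = record
  { connectionSet = withCodes (1 ∷ 3 ∷ 4 ∷ 10 ∷ 12 ∷ [])
  ; q             = 10
  ; roots         = 1 ∷ 5 ∷ 8 ∷ []
  ; points        = 4 ∷ 6 ∷ []
  ; values        = 4 ∷ 5 ∷ []
  ; reachable     = (1 ∷ 1 ∷ []) ∷ (2 ∷ 3 ∷ []) ∷ (3 ∷ 5 ∷ []) ∷ (4 ∷ 9 ∷ []) ∷ (5 ∷ 4 ∷ []) ∷ (6 ∷ 4 ∷ []) ∷ (7 ∷ 9 ∷ []) ∷ (8 ∷ 5 ∷ []) ∷
                    (9 ∷ 3 ∷ []) ∷ (10 ∷ 1 ∷ []) ∷ []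
  }

Heis₂₇-certificate : Certificate Heis₂₇
Heis₂₇-certificate = record
  { connectionSet = withCodes (1 ∷ 2 ∷ 3 ∷ 6 ∷ 8 ∷ 13 ∷ [])
  ; q             = 10
  ; roots         = 0 ∷ 6 ∷ 8 ∷ []
  ; points        = 1 ∷ 10 ∷ []
  ; values        = 7 ∷ 5 ∷ []
  ; reachable     = (1 ∷ 1 ∷ []) ∷ (1 ∷ 10 ∷ []) ∷ (2 ∷ 3 ∷ []) ∷ (2 ∷ 8 ∷ []) ∷ (3 ∷ 5 ∷ []) ∷ (3 ∷ 6 ∷ []) ∷ (4 ∷ 2 ∷ []) ∷ (4 ∷ 9 ∷ []) ∷
                    (5 ∷ 4 ∷ []) ∷ (5 ∷ 7 ∷ []) ∷ (6 ∷ 4 ∷ []) ∷ (6 ∷ 7 ∷ []) ∷ (7 ∷ 2 ∷ []) ∷ (7 ∷ 9 ∷ []) ∷ (8 ∷ 5 ∷ []) ∷ (8 ∷ 6 ∷ []) ∷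
                    (9 ∷ 3 ∷ []) ∷ (9 ∷ 8 ∷ []) ∷ (10 ∷ 1 ∷ []) ∷ (10 ∷ 10 ∷ []) ∷ []
  }

[C₄⋉C₃]×C₂-certificate : Certificate [C₄⋉C₃]×C₂
[C₄⋉C₃]×C₂-certificate = record
  { connectionSet = withCodes (1 ∷ 2 ∷ 3 ∷ 7 ∷ 8 ∷ 9 ∷ 16 ∷ 22 ∷ [])
  ; q             = 18
  ; roots         = 0 ∷ 4 ∷ 8 ∷ 15 ∷ []
  ; points        = 6 ∷ 17 ∷ []
  ; values        = 1 ∷ 4 ∷ []
  ; reachable     = (1 ∷ 1 ∷ []) ∷ (1 ∷ 7 ∷ []) ∷ (1 ∷ 11 ∷ []) ∷ (2 ∷ 10 ∷ []) ∷ (2 ∷ 13 ∷ []) ∷ (2 ∷ 15 ∷ []) ∷ (3 ∷ 10 ∷ []) ∷ (3 ∷ 13 ∷ []) ∷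
                    (3 ∷ 15 ∷ []) ∷ (4 ∷ 5 ∷ []) ∷ (4 ∷ 16 ∷ []) ∷ (4 ∷ 17 ∷ []) ∷ (5 ∷ 4 ∷ []) ∷ (5 ∷ 6 ∷ []) ∷ (5 ∷ 9 ∷ []) ∷ (6 ∷ 5 ∷ []) ∷
                    (6 ∷ 16 ∷ []) ∷ (6 ∷ 17 ∷ []) ∷ (7 ∷ 1 ∷ []) ∷ (7 ∷ 7 ∷ []) ∷ (7 ∷ 11 ∷ []) ∷ (8 ∷ 8 ∷ []) ∷ (8 ∷ 12 ∷ []) ∷ (8 ∷ 18 ∷ []) ∷
                    (9 ∷ 5 ∷ []) ∷ (9 ∷ 16 ∷ []) ∷ (9 ∷ 17 ∷ []) ∷ (10 ∷ 2 ∷ []) ∷ (10 ∷ 3 ∷ []) ∷ (10 ∷ 14 ∷ []) ∷ (11 ∷ 1 ∷ []) ∷ (11 ∷ 7 ∷ []) ∷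
                    (11 ∷ 11 ∷ []) ∷ (12 ∷ 8 ∷ []) ∷ (12 ∷ 12 ∷ []) ∷ (12 ∷ 18 ∷ []) ∷ (13 ∷ 2 ∷ []) ∷ (13 ∷ 3 ∷ []) ∷ (13 ∷ 14 ∷ []) ∷ (14 ∷ 10 ∷ []) ∷
                    (14 ∷ 13 ∷ []) ∷ (14 ∷ 15 ∷ []) ∷ (15 ∷ 2 ∷ []) ∷ (15 ∷ 3 ∷ []) ∷ (15 ∷ 14 ∷ []) ∷ (16 ∷ 4 ∷ []) ∷ (16 ∷ 6 ∷ []) ∷ (16 ∷ 9 ∷ []) ∷
                    (17 ∷ 4 ∷ []) ∷ (17 ∷ 6 ∷ []) ∷ (17 ∷ 9 ∷ []) ∷ (18 ∷ 8 ∷ []) ∷ (18 ∷ 12 ∷ []) ∷ (18 ∷ 18 ∷ []) ∷ []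
  }

[C₃×C₃]⋊C₄-certificate : Certificate [C₃×C₃]⋊C₄
[C₃×C₃]⋊C₄-certificate = record
  { connectionSet = withCodes (9 ∷ 10 ∷ 12 ∷ 27 ∷ 28 ∷ 30 ∷ [])
  ; q             = 16
  ; roots         = 0 ∷ 6 ∷ 11 ∷ []
  ; points        = 1 ∷ 16 ∷ []
  ; values        = 9 ∷ 9 ∷ []
  ; reachable     = (1 ∷ 1 ∷ []) ∷ (1 ∷ 16 ∷ []) ∷ (2 ∷ 8 ∷ []) ∷ (2 ∷ 9 ∷ []) ∷ (3 ∷ 6 ∷ []) ∷ (3 ∷ 11 ∷ []) ∷ (4 ∷ 4 ∷ []) ∷ (4 ∷ 13 ∷ []) ∷
                    (5 ∷ 7 ∷ []) ∷ (5 ∷ 10 ∷ []) ∷ (6 ∷ 3 ∷ []) ∷ (6 ∷ 14 ∷ []) ∷ (7 ∷ 5 ∷ []) ∷ (7 ∷ 12 ∷ []) ∷ (8 ∷ 2 ∷ []) ∷ (8 ∷ 15 ∷ []) ∷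
                    (9 ∷ 2 ∷ []) ∷ (9 ∷ 15 ∷ []) ∷ (10 ∷ 5 ∷ []) ∷ (10 ∷ 12 ∷ []) ∷ (11 ∷ 3 ∷ []) ∷ (11 ∷ 14 ∷ []) ∷ (12 ∷ 7 ∷ []) ∷ (12 ∷ 10 ∷ []) ∷
                    (13 ∷ 4 ∷ []) ∷ (13 ∷ 13 ∷ []) ∷ (14 ∷ 6 ∷ []) ∷ (14 ∷ 11 ∷ []) ∷ (15 ∷ 8 ∷ []) ∷ (15 ∷ 9 ∷ []) ∷ (16 ∷ 1 ∷ []) ∷ (16 ∷ 16 ∷ []) ∷ []
  }

lemma2p7 : ¬ CayleyIntegral A₄
         × ¬ CayleyIntegral C₄⋊C₄
         × ¬ CayleyIntegral S₃×C₃
         × ¬ CayleyIntegral SL[2,3]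
         × ¬ CayleyIntegral [C₄⋉C₃]×C₂
         × ¬ CayleyIntegral [C₄×C₂]⋊C₄
         × ¬ CayleyIntegral Heis₂₇
         × ¬ CayleyIntegral [C₃×C₃]⋊C₄
lemma2p7 = refute A₄-certificate tt
         , refute C₄⋊C₄-certificate tt
         , refute S₃×C₃-certificate tt
         , refute SL[2,3]-certificate tt
         , refute [C₄⋉C₃]×C₂-certificate tt
         , refute [C₄×C₂]⋊C₄-certificate tt
         , refute Heis₂₇-certificate tt
         , refute [C₃×C₃]⋊C₄-certificate tt
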